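{- Let $x$ be a node of a top tree (all of whose clusters are valid and which satisfies the orientation invariant) such that $x$ has a grandparent. If $x$ and its grandparent are both point clusters, then $\mathrm{rotate\_up}(x)$ is allowed, i.e. $\mathrm{sibling}(x) \cup \mathrm{sibling}(\mathrm{parent}(x))$ is a valid cluster.
   Context: Let $F$ be a forest (the underlying forest) in which some vertices are marked as exposed. For a set $C$ of edges of $F$, a vertex $w$ is a boundary vertex of $C$ if $w$ is incident to an edge of $C$ and either $w$ is exposed or $w$ is incident to an edge of $F$ not in $C$. A cluster is a nonempty connected set of edges; it is valid if it has at most two boundary vertices; a valid cluster is a path cluster if it has exactly two boundary vertices and a point cluster if it has zero or one. A top tree for a tree $T$ of $F$ (with at least one edge) is a rooted tree in which every internal node has exactly two children and whose leaves are in bijection with the edges of $T$; each node is identified with the cluster consisting of the edges at the leaves of its subtree, and every such cluster is required to be connected and valid. The two children of an internal node share exactly one vertex, its central vertex. Orientation: each internal node has ordered children (left, right), each leaf has ordered endpoints (left, right). For a leaf, a boundary vertex is its left/right boundary vertex if it is its left/right endpoint; for an internal node, a boundary vertex is middle if it equals the central vertex, and otherwise left/right according to whether it is a boundary vertex of the left/right child. Leftmost boundary vertex: the left one if it exists, else the middle one if it exists, else none; rightmost symmetric. Orientation invariant: for every internal node, the rightmost boundary vertex of the left child and the leftmost boundary vertex of the right child exist and equal the central vertex. Rotation: for a node $x$ with parent $y$ and grandparent $z$, let $a=\mathrm{sibling}(x)$ and $b=\mathrm{sibling}(y)$. The operation $\mathrm{rotate\_up}(x)$ is allowed iff $a\cup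 b$ is a valid cluster; it makes $a$ and $b$ the children of $y$ (so $y$ now represents $a\cup b$) and makes $x$ and $y$ the children of $z$, leaving all other parent–child relations unchanged, and then adjusts child orders and orientations (possibly reversing the orientation of whole subtrees) in any way such that the orientation invariant holds. -}

module Defs where

open import Data.Nat using (ℕ)
open import Data.Fin using (Fin)
open import Data.Bool using (Bool; true; false; if_then_else_)
open import Data.Product using (_×_; _,_; proj₁; proj₂; ∃; ∃-syntax)
open import Data.Sum using (_⊎_)
open import Data.Empty using (⊥)
open import Data.Unit using (⊤)
open import Data.List using (List; []; _∷_; _++_)
open import Data.List.Membership.Propositional using (_∈_)
open import Data.List.Relation.Unary.Unique.Propositional using (Unique)
open import Relation.Nullary using (¬_)
open import Relation.Binary.PropositionalEquality using (_≡_; _≢_)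

record Graph : Set where
  field
    n       : ℕ
    m       : ℕ
    ends    : Fin m → Fin n × Fin n
    exposed : Fin n → Bool

-- A leaf carries its edge
-- and its orientation: leaf e false has left endpoint proj₁ (ends e),
-- leaf e true has left endpoint proj₂ (ends e).
data TopTree (m : ℕ) : Set where
  leaf : Fin m → Bool → TopTree m
  node : TopTree m → TopTree m → TopTree m

-- Subtree occurrences (nodes of the top tree).
data _⊑_ {m : ℕ} : TopTree m → TopTree m → Set where
  here : ∀ {t} → t ⊑ t
  inl  : ∀ {s l r} → s ⊑ l → s ⊑ node l r
  inr  : ∀ {s l r} → s ⊑ r → s ⊑ node l r

-- z is the grandparent of x, a = sibling(x), b = sibling(parent(x)).
data GrandChild {m : ℕ} (x a b : TopTree m) : TopTree m → Set where
  ll : GrandChild x a b (node (node x a) b)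
  lr : GrandChild x a b (node (node a x) b)
  rl : GrandChild x a b (node b (node x a))
  rr : GrandChild x a b (node b (node a x))

leaves : ∀ {m} → TopTree m → List (Fin m)
leaves (leaf e _) = e ∷ []
leaves (node l r) = leaves l ++ leaves r

module _ (G : Graph) where
  open Graph G

  EdgeSet : Set₁
  EdgeSet = Fin m → Set

  Incident : Fin n → Fin m → Set
  Incident v e = (v ≡ proj₁ (ends e)) ⊎ (v ≡ proj₂ (ends e))

  Adjacent : Fin m → Fin m → Set
  Adjacent e e′ = ∃[ v ] (Incident v e × Incident v e′)

  data VReach (A : EdgeSet) (u : Fin n) : Fin n → Set where
    here : VReach A u u
    step : ∀ {v w} (e : Fin m) → VReach A u v → A e →
           Incident v e → Incident w e → VReach A u w

  -- F is a forest: no cycle, i.e. no edge whose endpoints are joined by a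
  -- walk avoiding that edge (this also excludes loops and parallel edges).
  IsForest : Set
  IsForest = ∀ e → ¬ VReach (λ e′ → e′ ≢ e) (proj₁ (ends e)) (proj₂ (ends e))

  data EReach (C : EdgeSet) (e : Fin m) : Fin m → Set where
    base : C e → EReach C e e
    step : ∀ {e′ e″} → EReach C e e′ → C e″ → Adjacent e′ e″ → EReach C e e″

  Nonempty : EdgeSet → Set
  Nonempty C = ∃[ e ] C e

  Connected : EdgeSet → Set
  Connected C = ∀ e e′ → C e → C e′ → EReach C e e′

  Boundary : EdgeSet → Fin n → Set
  Boundary C w = (∃[ e ] (C e × Incident w e)) ×
                 ((exposed w ≡ true) ⊎ (∃[ e ] (¬ C e × Incident w e)))

  AtMostTwo : (Fin n → Set) → Set
  AtMostTwo P = ∀ u v w → P u → P v → P w → (u ≡ v) ⊎ (u ≡ w) ⊎ (v ≡ w)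

  AtMostOne : (Fin n → Set) → Set
  AtMostOne P = ∀ u v → P u → P v → u ≡ v

  IsCluster : EdgeSet → Set
  IsCluster C = Nonempty C × Connected C

  ValidCluster : EdgeSet → Set
  ValidCluster C = IsCluster C × AtMostTwo (Boundary C)

  PointCluster : EdgeSet → Set
  PointCluster C = ValidCluster C × AtMostOne (Boundary C)

  PathCluster : EdgeSet → Set
  PathCluster C = ValidCluster C × ∃[ u ] ∃[ v ] (u ≢ v × Boundary C u × Boundary C v)

  -- a tree of F (with at least one edge): the edge set of a connected
  -- component of F containing an edge
  IsTreeOf : EdgeSet → Set
  IsTreeOf T = Nonempty T × Connected T × (∀ e e′ → T e → Adjacent e e′ → T e′)

  cluster : TopTree m → EdgeSet
  cluster (leaf e _) e′ = e′ ≡ e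
  cluster (node l r) e′ = cluster l e′ ⊎ cluster r e′

  IsTopTreeFor : EdgeSet → TopTree m → Set
  IsTopTreeFor T t =
    Unique (leaves t) ×
    (∀ e → (e ∈ leaves t → T e) × (T e → e ∈ leaves t)) ×
    (∀ s → s ⊑ t → ValidCluster (cluster s))

  leftEnd rightEnd : Fin m → Bool → Fin n
  leftEnd  e f = if f then proj₂ (ends e) else proj₁ (ends e)
  rightEnd e f = if f then proj₁ (ends e) else proj₂ (ends e)

  Shared : TopTree m → TopTree m → Fin n → Set
  Shared l r w = (∃[ e ] (cluster l e × Incident w e)) × (∃[ e ] (cluster r e × Incident w e))

  MiddleBV LeftBV RightBV : TopTree m → Fin n → Set
  MiddleBV (leaf e f) w = ⊥
  MiddleBV (node l r) w = Boundary (cluster (node l r)) w × Shared l r w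
  LeftBV (leaf e f) w = Boundary (cluster (leaf e f)) w × w ≡ leftEnd e f
  LeftBV (node l r) w = Boundary (cluster (node l r)) w × ¬ Shared l r w × Boundary (cluster l) w
  RightBV (leaf e f) w = Boundary (cluster (leaf e f)) w × w ≡ rightEnd e f
  RightBV (node l r) w = Boundary (cluster (node l r)) w × ¬ Shared l r w × Boundary (cluster r) w

  LeftmostBV RightmostBV : TopTree m → Fin n → Set
  LeftmostBV  t w = LeftBV t w  ⊎ ((¬ (∃[ v ] LeftBV t v))  × MiddleBV t w)
  RightmostBV t w = RightBV t w ⊎ ((¬ (∃[ v ] RightBV t v)) × MiddleBV t w)

  OrientInv : TopTree m → Set
  OrientInv (leaf e f) = ⊤
  OrientInv (node l r) =
    OrientInv l × OrientInv r ×
    (∃[ c ] RightmostBV l c) × (∀ c → RightmostBV l c → Shared l r c) ×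
    (∃[ c ] LeftmostBV r c)  × (∀ c → LeftmostBV r c → Shared l r c)

{-# OPTIONS --safe #-}
module Submission where

-- Let y be the parent of x. The central vertex of y touches both x and its
-- sibling a, so it is a boundary vertex of x; as x is a point cluster it is
-- the only one. Hence every boundary vertex of a ∪ b is either that vertex
-- (when witnessed by an edge of x) or a boundary vertex of the point cluster
-- z, giving at most two. For connectivity, the central vertex of z is touched
-- by b and by y = x ∪ a; if only by x, it is again the boundary vertex of x,
-- which a touches.

open import Defs
open import Data.Nat using (ℕ)
open import Data.Sum using (_⊎_; inj₁; inj₂; map₁; swap; assocʳ; assocˡ)
open import Data.Product using (_×_; _,_; proj₁; proj₂; ∃-syntax)
open import Data.List using ([]; _∷_; _++_)
open import Data.List.Membership.Propositional using (_∈_)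
open import Data.List.Membership.Propositional.Properties using (∈-++⁺ˡ; ∈-++⁺ʳ)
open import Data.List.Relation.Unary.Any using (here)
open import Data.List.Relation.Unary.All as All using (All; []; _∷_)
import Data.List.Relation.Unary.All.Properties as All
open import Data.List.Relation.Unary.AllPairs using (AllPairs; []; _∷_)
open import Data.List.Relation.Unary.Unique.Propositional using (Unique)
open import Data.Fin using (Fin; _≟_)
open import Relation.Nullary using (¬_; yes; no)
open import Relation.Nullary.Decidable using (_⊎-dec_)
open import Relation.Unary using (Decidable; _⊆_; _≐_; _∪_; _⊥_)
open import Relation.Unary.Properties using (≐-sym)
open import Relation.Binary.PropositionalEquality using (refl)

AllPairs-++⁻ : ∀ {A : Set} {R : A → A → Set} xs {ys} → AllPairs R (xs ++ ys) →
  AllPairs R xs × AllPairs R ys × All (λ x → All (R x) ys) xs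
AllPairs-++⁻ []       rs        = [] , rs , []
AllPairs-++⁻ (x ∷ xs) (px ∷ rs) with AllPairs-++⁻ xs rs
... | rxs , rys , rxys = All.++⁻ˡ xs px ∷ rxs , rys , All.++⁻ʳ xs px ∷ rxys

Unique-++⁻-disjoint : ∀ {A : Set} xs {ys} {v : A} → Unique (xs ++ ys) → v ∈ xs → ¬ v ∈ ys
Unique-++⁻-disjoint xs u v∈xs v∈ys =
  All.lookup (All.lookup (proj₂ (proj₂ (AllPairs-++⁻ xs u))) v∈xs) v∈ys refl

data Siblings {m : ℕ} (s u : TopTree m) : TopTree m → Set where
  left  : Siblings s u (node s u)
  right : Siblings s u (node u s)

module _ {m : ℕ} where

  ⊑-trans : {s u v : TopTree m} → s ⊑ u → u ⊑ v → s ⊑ v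
  ⊑-trans p here    = p
  ⊑-trans p (inl q) = inl (⊑-trans p q)
  ⊑-trans p (inr q) = inr (⊑-trans p q)

  Siblings-sym : {s u p : TopTree m} → Siblings s u p → Siblings u s p
  Siblings-sym left  = right
  Siblings-sym right = left

  Siblings⇒⊑ : {s u p : TopTree m} → Siblings s u p → s ⊑ p
  Siblings⇒⊑ left  = inl here
  Siblings⇒⊑ right = inr here

  GrandChild⇒Siblings : {x a b z : TopTree m} → GrandChild x a b z →
    ∃[ y ] (Siblings x a y × Siblings y b z)
  GrandChild⇒Siblings ll = _ , left  , left
  GrandChild⇒Siblings lr = _ , right , left
  GrandChild⇒Siblings rl = _ , left  , right
  GrandChild⇒Siblings rr = _ , right , right

  Unique-⊑ : {s t : TopTree m} → s ⊑ t → Unique (leaves t) → Unique (leaves s)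
  Unique-⊑ here                u = u
  Unique-⊑ (inl {l = l} s⊑l) u = Unique-⊑ s⊑l (proj₁ (AllPairs-++⁻ (leaves l) u))
  Unique-⊑ (inr {l = l} s⊑r) u = Unique-⊑ s⊑r (proj₁ (proj₂ (AllPairs-++⁻ (leaves l) u)))

module _ (G : Graph) where
  open Graph G

  Touches : EdgeSet G → Fin n → Set
  Touches C w = ∃[ e ] (C e × Incident G w e)

  Touches-⊆ : {C D : EdgeSet G} {w : Fin n} → C ⊆ D → Touches C w → Touches D w
  Touches-⊆ C⊆D (e , e∈C , w∼e) = e , C⊆D e∈C , w∼e

  Adjacent-sym : {e e′ : Fin m} → Adjacent G e e′ → Adjacent G e′ e
  Adjacent-sym (v , v∼e , v∼e′) = v , v∼e′ , v∼e

  EReach-mono : {C D : EdgeSet G} {e e′ : Fin m} → C ⊆ D → EReach G C e e′ → EReach G D e e′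
  EReach-mono C⊆D (base e∈C)          = base (C⊆D e∈C)
  EReach-mono C⊆D (step path e∈C adj) = step (EReach-mono C⊆D path) (C⊆D e∈C) adj

  EReach-trans : {C : EdgeSet G} {e e′ e″ : Fin m} →
    EReach G C e e′ → EReach G C e′ e″ → EReach G C e e″
  EReach-trans p (base _)         = p
  EReach-trans p (step q e∈C adj) = step (EReach-trans p q) e∈C adj

  ∪-connected : {A B : EdgeSet G} {a b : Fin m} → Connected G A → Connected G B →
    A a → B b → Adjacent G a b → Connected G (A ∪ B)
  ∪-connected {A} {B} conA conB a∈A b∈B a∼b = go
    where
    go : Connected G (A ∪ B)
    go e e′ (inj₁ p) (inj₁ q) = EReach-mono inj₁ (conA e e′ p q)
    go e e′ (inj₂ p) (inj₂ q) = EReach-mono inj₂ (conB e e′ p q)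
    go e e′ (inj₁ p) (inj₂ q) =
      EReach-trans (step (EReach-mono inj₁ (conA e _ p a∈A)) (inj₂ b∈B) a∼b)
                   (EReach-mono inj₂ (conB _ e′ b∈B q))
    go e e′ (inj₂ p) (inj₁ q) =
      EReach-trans (step (EReach-mono inj₂ (conB e _ p b∈B)) (inj₁ a∈A) (Adjacent-sym a∼b))
                   (EReach-mono inj₁ (conA _ e′ a∈A q))

  Boundary-intro : {C : EdgeSet G} {w : Fin n} → Touches C w → Touches (λ e → ¬ C e) w →
    Boundary G C w
  Boundary-intro inside outside = inside , inj₂ outside

  Boundary-resp : {C D : EdgeSet G} → C ≐ D → Boundary G C ⊆ Boundary G D
  Boundary-resp (C⊆D , D⊆C) (inside , inj₁ exp) = Touches-⊆ C⊆D inside , inj₁ exp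
  Boundary-resp (C⊆D , D⊆C) (inside , inj₂ (e , e∉C , w∼e)) =
    Touches-⊆ C⊆D inside , inj₂ (e , (λ e∈D → e∉C (D⊆C e∈D)) , w∼e)

  AtMostOne-resp : {P Q : Fin n → Set} → Q ⊆ P → AtMostOne G P → AtMostOne G Q
  AtMostOne-resp Q⊆P one u v qu qv = one u v (Q⊆P qu) (Q⊆P qv)

  Boundary-split : {X Y : EdgeSet G} → Decidable X → X ⊥ Y →
    Boundary G Y ⊆ Boundary G X ∪ Boundary G (X ∪ Y)
  Boundary-split {X} {Y} X? X⊥Y (inside@(e , e∈Y , w∼e) , outside) with outside
  ... | inj₁ exp = inj₂ (Touches-⊆ inj₂ inside , inj₁ exp)
  ... | inj₂ (e′ , e′∉Y , w∼e′) with X? e′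
  ...   | yes e′∈X = inj₁ (Boundary-intro (e′ , e′∈X , w∼e′) (e , (λ e∈X → X⊥Y (e∈X , e∈Y)) , w∼e))
  ...   | no  e′∉X = inj₂ (Boundary-intro (Touches-⊆ inj₂ inside) (e′ , e′∉X∪Y , w∼e′))
    where
    e′∉X∪Y : ¬ (X ∪ Y) e′
    e′∉X∪Y (inj₁ e′∈X) = e′∉X e′∈X
    e′∉X∪Y (inj₂ e′∈Y) = e′∉Y e′∈Y

  AtMostTwo-⊆-∪ : {P Q R : Fin n → Set} → P ⊆ Q ∪ R → AtMostOne G Q → AtMostOne G R →
    AtMostTwo G P
  AtMostTwo-⊆-∪ P⊆Q∪R oneQ oneR u v w pu pv pw with P⊆Q∪R pu | P⊆Q∪R pv | P⊆Q∪R pw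
  ... | inj₁ qu | inj₁ qv | _       = inj₁ (oneQ u v qu qv)
  ... | inj₁ qu | inj₂ _  | inj₁ qw = inj₂ (inj₁ (oneQ u w qu qw))
  ... | inj₁ _  | inj₂ rv | inj₂ rw = inj₂ (inj₂ (oneR v w rv rw))
  ... | inj₂ _  | inj₁ qv | inj₁ qw = inj₂ (inj₂ (oneQ v w qv qw))
  ... | inj₂ ru | inj₁ _  | inj₂ rw = inj₂ (inj₁ (oneR u w ru rw))
  ... | inj₂ ru | inj₂ rv | _       = inj₁ (oneR u v ru rv)

  -- If the edge of X ∪ A at c₂ is in X, then c₁ and c₂ are both boundary
  -- vertices of X, so c₁ = c₂ and A meets B there.
  adjacent-across : {X A B : EdgeSet G} {c₁ c₂ : Fin n} → X ⊥ A → X ⊥ B →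
    AtMostOne G (Boundary G X) →
    Touches X c₁ → Touches A c₁ → Touches (X ∪ A) c₂ → Touches B c₂ →
    ∃[ a ] ∃[ b ] (A a × B b × Adjacent G a b)
  adjacent-across _ _ _ _ _ (e , inj₂ e∈A , c₂∼e) (b , b∈B , c₂∼b) =
    e , b , e∈A , b∈B , _ , c₂∼e , c₂∼b
  adjacent-across {c₁ = c₁} {c₂} X⊥A X⊥B one touchX₁ (a , a∈A , c₁∼a) (e , inj₁ e∈X , c₂∼e)
                  (b , b∈B , c₂∼b)
    with one c₁ c₂ (Boundary-intro touchX₁ (a , (λ a∈X → X⊥A (a∈X , a∈A)) , c₁∼a))
                   (Boundary-intro (e , e∈X , c₂∼e) (b , (λ b∈X → X⊥B (b∈X , b∈B)) , c₂∼b))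
  ... | refl = a , b , a∈A , b∈B , c₁ , c₁∼a , c₂∼b

  ∪-valid-beside-point-cluster : {X A B : EdgeSet G} {c₁ c₂ : Fin n} → Decidable X → X ⊥ A → X ⊥ B →
    ValidCluster G A → ValidCluster G B →
    AtMostOne G (Boundary G X) → AtMostOne G (Boundary G (X ∪ (A ∪ B))) →
    Touches X c₁ → Touches A c₁ → Touches (X ∪ A) c₂ → Touches B c₂ →
    ValidCluster G (A ∪ B)
  ∪-valid-beside-point-cluster {X} {A} {B} X? X⊥A X⊥B (((a₀ , a₀∈A) , conA) , _) ((_ , conB) , _) oneX oneZ
                   touchX₁ touchA₁ touchXA₂ touchB₂
    with adjacent-across X⊥A X⊥B oneX touchX₁ touchA₁ touchXA₂ touchB₂
  ... | a , b , a∈A , b∈B , a∼b =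
    ((a₀ , inj₁ a₀∈A) , ∪-connected conA conB a∈A b∈B a∼b) ,
    AtMostTwo-⊆-∪ (Boundary-split X? X⊥AB) oneX oneZ
    where
    X⊥AB : X ⊥ A ∪ B
    X⊥AB (e∈X , inj₁ e∈A) = X⊥A (e∈X , e∈A)
    X⊥AB (e∈X , inj₂ e∈B) = X⊥B (e∈X , e∈B)

  cluster⇒∈leaves : (s : TopTree m) → cluster G s ⊆ (_∈ leaves s)
  cluster⇒∈leaves (leaf _ _) refl     = here refl
  cluster⇒∈leaves (node l r) (inj₁ p) = ∈-++⁺ˡ (cluster⇒∈leaves l p)
  cluster⇒∈leaves (node l r) (inj₂ p) = ∈-++⁺ʳ (leaves l) (cluster⇒∈leaves r p)

  cluster-dec : (s : TopTree m) → Decidable (cluster G s)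
  cluster-dec (leaf e _) e′ = e′ ≟ e
  cluster-dec (node l r) e  = cluster-dec l e ⊎-dec cluster-dec r e

  OrientInv-⊑ : {s t : TopTree m} → s ⊑ t → OrientInv G t → OrientInv G s
  OrientInv-⊑ here      o = o
  OrientInv-⊑ (inl s⊑l) o = OrientInv-⊑ s⊑l (proj₁ o)
  OrientInv-⊑ (inr s⊑r) o = OrientInv-⊑ s⊑r (proj₁ (proj₂ o))

  Siblings-cluster : {s u p : TopTree m} → Siblings s u p → cluster G p ≐ cluster G s ∪ cluster G u
  Siblings-cluster left  = (λ e∈p → e∈p) , (λ e∈p → e∈p)
  Siblings-cluster right = swap , swap

  Siblings-disjoint : {s u p : TopTree m} → Siblings s u p → Unique (leaves p) →
    cluster G s ⊥ cluster G u
  Siblings-disjoint {s} {u} left  uniq (e∈s , e∈u) =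
    Unique-++⁻-disjoint (leaves s) uniq (cluster⇒∈leaves s e∈s) (cluster⇒∈leaves u e∈u)
  Siblings-disjoint {s} {u} right uniq (e∈s , e∈u) =
    Unique-++⁻-disjoint (leaves u) uniq (cluster⇒∈leaves u e∈u) (cluster⇒∈leaves s e∈s)

  Siblings-central : {s u p : TopTree m} → Siblings s u p → OrientInv G p →
    ∃[ c ] (Touches (cluster G s) c × Touches (cluster G u) c)
  Siblings-central left  (_ , _ , (c , rightmost) , central , _) = c , central c rightmost
  Siblings-central right (_ , _ , (c , rightmost) , central , _) with central c rightmost
  ... | touch-u , touch-s = c , touch-s , touch-u

  Siblings²-cluster : {x a y b z : TopTree m} → Siblings x a y → Siblings y b z →
    cluster G z ≐ cluster G x ∪ (cluster G a ∪ cluster G b)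
  Siblings²-cluster x∼a y∼b =
    (λ e∈z → assocʳ (map₁ (proj₁ Y≐X∪A) (proj₁ Z≐Y∪B e∈z))) ,
    (λ e∈xab → proj₂ Z≐Y∪B (map₁ (proj₂ Y≐X∪A) (assocˡ e∈xab)))
    where
    Y≐X∪A = Siblings-cluster x∼a
    Z≐Y∪B = Siblings-cluster y∼b

  rotate-up-allowed : {x a y b z : TopTree m} → Siblings x a y → Siblings y b z →
    Unique (leaves z) → OrientInv G z → (∀ s → s ⊑ z → ValidCluster G (cluster G s)) →
    AtMostOne G (Boundary G (cluster G x)) → AtMostOne G (Boundary G (cluster G z)) →
    ValidCluster G (cluster G a ∪ cluster G b)
  rotate-up-allowed {x} {a} {b = b} x∼a y∼b uniq orient valid oneX oneZ
    with Siblings-central x∼a (OrientInv-⊑ (Siblings⇒⊑ y∼b) orient) | Siblings-central y∼b orient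
  ... | c₁ , touchX₁ , touchA₁ | c₂ , touchY₂ , touchB₂ =
    ∪-valid-beside-point-cluster (cluster-dec x) X⊥A X⊥B
      (valid a (⊑-trans (Siblings⇒⊑ (Siblings-sym x∼a)) (Siblings⇒⊑ y∼b)))
      (valid b (Siblings⇒⊑ (Siblings-sym y∼b)))
      oneX (AtMostOne-resp (Boundary-resp (≐-sym (Siblings²-cluster x∼a y∼b))) oneZ)
      touchX₁ touchA₁ (Touches-⊆ (proj₁ (Siblings-cluster x∼a)) touchY₂) touchB₂
    where
    X⊥A : cluster G x ⊥ cluster G a
    X⊥A = Siblings-disjoint x∼a (Unique-⊑ (Siblings⇒⊑ y∼b) uniq)
    X⊥B : cluster G x ⊥ cluster G b
    X⊥B (e∈x , e∈b) = Siblings-disjoint y∼b uniq (proj₂ (Siblings-cluster x∼a) (inj₁ e∈x) , e∈b)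

lemma4p4 : (G : Graph) → IsForest G →
    (T : EdgeSet G) → IsTreeOf G T →
    (t : TopTree (Graph.m G)) → IsTopTreeFor G T t → OrientInv G t →
    (x a b z : TopTree (Graph.m G)) → z ⊑ t → GrandChild x a b z →
    PointCluster G (cluster G x) → PointCluster G (cluster G z) →
    ValidCluster G (λ e → cluster G a e ⊎ cluster G b e)
lemma4p4 G _ T _ t (uniq , _ , valid) orient x a b z z⊑t gc (_ , oneX) (_ , oneZ)
  with GrandChild⇒Siblings gc
... | y , x∼a , y∼b =
  rotate-up-allowed G x∼a y∼b (Unique-⊑ z⊑t uniq) (OrientInv-⊑ G z⊑t orient)
    (λ s s⊑z → valid s (⊑-trans s⊑z z⊑t)) oneX oneZ
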